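{- Let $T$ be a tree with minimal dominating set $M$. Let $s$ be a stem of $T$ and let $L$ be the set of leaf neighbours of $s$. If $s\in M$ and no non-leaf neighbour of $s$ lies in $N_1(M)$, then $M'=(M\cup L)\setminus\{s\}$ is a minimal dominating set of $T$ and $M'$ is adjacent to $M$ in $\mathcal{R}(T)$.
   Context: All graphs are finite, simple and undirected; $N(v)$ denotes the open neighbourhood of $v$ and $N[v]=N(v)\cup\{v\}$. A set $S\subseteq V(G)$ is a dominating set if every vertex of $G$ is in $S$ or adjacent to a vertex of $S$; it is a minimal dominating set if no proper subset of $S$ is a dominating set. The reconfiguration graph $\mathcal{R}(G)$ has as vertex set the collection of all minimal dominating sets of $G$, and two minimal dominating sets $M_1,M_2$ are adjacent iff there is a vertex $v$ with either ($M_2\setminus M_1=\{v\}$ and $M_1\setminus M_2\subseteq N(v)$) or ($M_1\setminus M_2=\{v\}$ and $M_2\setminus M_1\subseteq N(v)$). A leaf is a vertex of degree 1; a stem is a vertex with a leaf neighbour. For a dominating set $S$, $N_1(S)=\{v\in V\setminus S: |N[v]\cap S|=1\}$. -}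

module Defs where

open import Data.Nat using (ℕ; _≤_; _≡ᵇ_)
open import Data.Bool using (Bool; _∧_)
open import Data.Fin using (Fin)
open import Data.Fin.Subset using (Subset; _∈_; _∉_; _⊆_; _⊂_; _∪_; _∩_; _-_; ⁅_⁆; ∣_∣; ⋃)
open import Data.Vec using (lookup; tabulate)
open import Data.List using (List; []; _∷_; _++_; [_]; length)
open import Data.List.Relation.Unary.Linked using (Linked)
open import Data.List.Relation.Unary.Unique.Propositional using (Unique)
open import Data.Product using (Σ; ∃; ∃-syntax; _×_) public
open import Relation.Nullary using (¬_)
open import Data.Sum using (_⊎_)
open import Relation.Binary.PropositionalEquality using (_≡_)

record Graph (n : ℕ) : Set where
  field
    N      : Fin n → Subset n
    sym    : ∀ {u v} → u ∈ N v → v ∈ N u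
    irrefl : ∀ {v} → v ∉ N v
open Graph public

module _ {n : ℕ} (G : Graph n) where

  Adj : Fin n → Fin n → Set
  Adj u v = v ∈ N G u

  N[_] : Fin n → Subset n
  N[ v ] = ⁅ v ⁆ ∪ N G v

  data Walk : Fin n → Fin n → Set where
    here : ∀ {v} → Walk v v
    step : ∀ {u w v} → Adj u w → Walk w v → Walk u v

  Connected : Set
  Connected = ∀ u v → Walk u v

  IsCycle : Fin n → List (Fin n) → Set
  IsCycle x ys = 2 ≤ length ys × Unique (x ∷ ys) × Linked Adj (x ∷ ys ++ [ x ])

  Acyclic : Set
  Acyclic = ∀ x ys → ¬ IsCycle x ys

  IsTree : Set
  IsTree = Connected × Acyclic

  Dominating : Subset n → Set
  Dominating S = ∀ v → v ∈ S ⊎ ∃[ u ] (u ∈ S × Adj v u)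

  MinimalDominating : Subset n → Set
  MinimalDominating S = Dominating S × (∀ S' → S' ⊂ S → ¬ Dominating S')

  IsLeaf : Fin n → Set
  IsLeaf v = ∣ N G v ∣ ≡ 1

  IsStem : Fin n → Set
  IsStem s = ∃[ l ] (Adj s l × IsLeaf l)

  leafNbrᵇ : Fin n → Fin n → Bool
  leafNbrᵇ s x = lookup (N G s) x ∧ (∣ N G x ∣ ≡ᵇ 1)

  LeafNbrs : Fin n → Subset n
  LeafNbrs s = tabulate (leafNbrᵇ s)

  InN₁ : Subset n → Fin n → Set
  InN₁ S v = v ∉ S × ∣ N[ v ] ∩ S ∣ ≡ 1

  OneSided : Subset n → Subset n → Set
  OneSided M₁ M₂ = ∃[ v ] ((∀ x → (x ∈ M₂ × x ∉ M₁) → x ≡ v) × (v ∈ M₂ × v ∉ M₁)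
                          × (∀ x → x ∈ M₁ → x ∉ M₂ → Adj v x))

  RAdj : Subset n → Subset n → Set
  RAdj M₁ M₂ = MinimalDominating M₁ × MinimalDominating M₂ ×
               (OneSided M₁ M₂ ⊎ OneSided M₂ M₁)

-- A minimal dominating set is a dominating set each of whose vertices has a
-- private neighbour. Removing the stem s breaks domination only at non-leaf
-- neighbours v ∉ M of s whose sole M-dominator is s, i.e. at v ∈ N₁(M); these
-- are excluded by hypothesis, and the leaves of s take over the rest. Each leaf
-- is its own private neighbour, and every other x ∈ M keeps its old one, since
-- the closed neighbourhood of a leaf lies inside that of its stem.
module Submission where

open import Defs
open import Data.Nat using (ℕ; _<_)
open import Data.Nat.Properties using (≡ᵇ⇒≡; ≡⇒≡ᵇ; n≮0; <-≤-trans; ≤-pred) renaming (_≟_ to _≟ℕ_)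
open import Data.Bool using (Bool; T)
open import Data.Bool.Properties using (T-≡; T-∧)
open import Data.Fin using (Fin; _≟_)
open import Data.Fin.Properties using (any?; ¬∀⟶∃¬)
open import Data.Fin.Subset using (Subset; _∈_; _∉_; _∪_; _∩_; _─_; _-_; ⁅_⁆; ∣_∣; outside)
open import Data.Fin.Subset.Properties
  using (_∈?_; ⊆-antisym; x∈⁅x⁆; x∈⁅y⁆⇒x≡y; x∈p∪q⁺; x∈p∪q⁻; x∈p∩q⁺; x∈p∩q⁻;
         ∣⁅x⁆∣≡1; p─q⊆p; x∈p∧x≢y⇒x∈p-y; x∈p⇒p-x⊂p; x∈p⇒∣p-x∣<∣p∣)
open import Data.Vec using (_∷_; lookup; tabulate; here; there)
open import Data.Vec.Properties using ([]=⇒lookup; lookup⇒[]=; lookup∘tabulate)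
open import Data.Product using (_,_; proj₁; proj₂)
open import Data.Sum using (_⊎_; inj₁; inj₂)
open import Data.Empty using (⊥-elim)
open import Function using (_∘_; Equivalence)
open import Relation.Nullary using (¬_; Dec; yes; no)
open import Relation.Nullary.Decidable using (_×-dec_; _⊎-dec_; ¬?; decidable-stable)
open import Relation.Binary.PropositionalEquality using (_≡_; _≢_; refl; trans; cong; subst)
import Relation.Binary.PropositionalEquality as ≡

open Equivalence using (to; from)

x∈p─q⇒x∉q : ∀ {n} (p q : Subset n) {x : Fin n} → x ∈ p ─ q → x ∉ q
x∈p─q⇒x∉q (_ ∷ p) (outside ∷ q) here        ()
x∈p─q⇒x∉q (_ ∷ p) (_       ∷ q) (there x∈) (there x∈q) = x∈p─q⇒x∉q p q x∈ x∈q

x∈p-y⇒x≢y : ∀ {n} (p : Subset n) {x y : Fin n} → x ∈ p - y → x ≢ y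
x∈p-y⇒x≢y p {y = y} x∈ refl = x∈p─q⇒x∉q p ⁅ y ⁆ x∈ (x∈⁅x⁆ y)

∣p∣≡1⇒x∈p⇒y∈p⇒x≡y : ∀ {n} {p : Subset n} {x y : Fin n} → ∣ p ∣ ≡ 1 → x ∈ p → y ∈ p → x ≡ y
∣p∣≡1⇒x∈p⇒y∈p⇒x≡y {p = p} {x} {y} ∣p∣≡1 x∈p y∈p with x ≟ y
... | yes x≡y = x≡y
... | no x≢y = ⊥-elim (n≮0 (<-≤-trans ∣p-x-y∣<∣p-x∣ (≤-pred ∣p-x∣<1)))
  where
  ∣p-x-y∣<∣p-x∣ : ∣ p - x - y ∣ < ∣ p - x ∣
  ∣p-x-y∣<∣p-x∣ = x∈p⇒∣p-x∣<∣p∣ (x∈p∧x≢y⇒x∈p-y y∈p (x≢y ∘ ≡.sym))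
  ∣p-x∣<1 : ∣ p - x ∣ < 1
  ∣p-x∣<1 = subst (∣ p - x ∣ <_) ∣p∣≡1 (x∈p⇒∣p-x∣<∣p∣ x∈p)

∈-tabulate⁻ : ∀ {n} {f : Fin n → Bool} {x : Fin n} → x ∈ tabulate f → T (f x)
∈-tabulate⁻ {f = f} {x} x∈ = from T-≡ (trans (≡.sym (lookup∘tabulate f x)) ([]=⇒lookup x∈))

∈-tabulate⁺ : ∀ {n} {f : Fin n → Bool} {x : Fin n} → T (f x) → x ∈ tabulate f
∈-tabulate⁺ {f = f} {x} t = lookup⇒[]= x _ (trans (lookup∘tabulate f x) (to T-≡ t))

∈⇒T-lookup : ∀ {n} {p : Subset n} {x : Fin n} → x ∈ p → T (lookup p x)
∈⇒T-lookup x∈ = from T-≡ ([]=⇒lookup x∈)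

T-lookup⇒∈ : ∀ {n} {p : Subset n} {x : Fin n} → T (lookup p x) → x ∈ p
T-lookup⇒∈ {p = p} {x} t = lookup⇒[]= x p (to T-≡ t)

module _ {n : ℕ} (G : Graph n) where

  Dominates : Fin n → Fin n → Set
  Dominates u v = u ≡ v ⊎ Adj G v u

  Dominated : Subset n → Fin n → Set
  Dominated S v = ∃[ u ] (u ∈ S × Dominates u v)

  PrivateNbr : Subset n → Fin n → Fin n → Set
  PrivateNbr S x p = Dominates x p × (∀ u → u ∈ S → Dominates u p → u ≡ x)

  dominated? : ∀ S v → Dec (Dominated S v)
  dominated? S v = any? (λ u → (u ∈? S) ×-dec ((u ≟ v) ⊎-dec (u ∈? N G v)))

  dominating⇒dominated : ∀ {S} → Dominating G S → ∀ v → Dominated S v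
  dominating⇒dominated D v with D v
  ... | inj₁ v∈S             = v , v∈S , inj₁ refl
  ... | inj₂ (u , u∈S , adj) = u , u∈S , inj₂ adj

  dominated⇒dominating : ∀ {S} → (∀ v → Dominated S v) → Dominating G S
  dominated⇒dominating D v with D v
  ... | u , u∈S , inj₁ refl = inj₁ u∈S
  ... | u , u∈S , inj₂ adj  = inj₂ (u , u∈S , adj)

  privateNbrs⇒minimal : ∀ S → Dominating G S → (∀ x → x ∈ S → ∃[ p ] PrivateNbr S x p) →
                        MinimalDominating G S
  privateNbrs⇒minimal S D P = D , λ { S' (S'⊆S , x , x∈S , x∉S') D' → notMinimal S'⊆S x∈S x∉S' D' }
    where
    notMinimal : ∀ {S' x} → (∀ {y} → y ∈ S' → y ∈ S) → x ∈ S → x ∉ S' → ¬ Dominating G S'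
    notMinimal S'⊆S x∈S x∉S' D' with P _ x∈S
    ... | p , _ , isPrivate with dominating⇒dominated D' p
    ... | u , u∈S' , up = x∉S' (subst (_∈ _) (isPrivate u (S'⊆S u∈S') up) u∈S')

  -- A vertex left undominated by S - x is a private neighbour of x.
  minimal⇒privateNbrs : ∀ S → MinimalDominating G S → ∀ x → x ∈ S → ∃[ p ] PrivateNbr S x p
  minimal⇒privateNbrs S (D , minimal) x x∈S = privateNbr (dominating⇒dominated D v)
    where
    undominated : ∃[ v ] ¬ Dominated (S - x) v
    undominated = ¬∀⟶∃¬ n (Dominated (S - x)) (dominated? (S - x))
                    (minimal (S - x) (x∈p⇒p-x⊂p x∈S) ∘ dominated⇒dominating)
    v : Fin n
    v = proj₁ undominated
    onlyX : ∀ {u} → u ∈ S → Dominates u v → u ≡ x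
    onlyX {u} u∈S uv with u ≟ x
    ... | yes u≡x = u≡x
    ... | no u≢x  = ⊥-elim (proj₂ undominated (u , x∈p∧x≢y⇒x∈p-y u∈S u≢x , uv))
    privateNbr : Dominated S v → ∃[ p ] PrivateNbr S x p
    privateNbr (u , u∈S , uv) = v , subst (λ w → Dominates w v) (onlyX u∈S uv) uv , λ _ → onlyX

  adj⇒≢ : ∀ {u v} → Adj G u v → v ≢ u
  adj⇒≢ uv refl = irrefl G uv

  ∈LeafNbrs⁻ : ∀ {s x} → x ∈ LeafNbrs G s → Adj G s x × IsLeaf G x
  ∈LeafNbrs⁻ {x = x} x∈L with to T-∧ (∈-tabulate⁻ x∈L)
  ... | sx , leaf = T-lookup⇒∈ sx , ≡ᵇ⇒≡ ∣ N G x ∣ 1 leaf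

  ∈LeafNbrs⁺ : ∀ {s x} → Adj G s x → IsLeaf G x → x ∈ LeafNbrs G s
  ∈LeafNbrs⁺ {x = x} sx leaf = ∈-tabulate⁺ (from T-∧ (∈⇒T-lookup sx , ≡⇒≡ᵇ ∣ N G x ∣ 1 leaf))

  leaf-nbr-unique : ∀ {s l u} → Adj G s l → IsLeaf G l → Adj G l u → u ≡ s
  leaf-nbr-unique sl leaf lu = ∣p∣≡1⇒x∈p⇒y∈p⇒x≡y leaf lu (sym G sl)

  leaf-N[]⊆stem-N[] : ∀ {s l p} → Adj G s l → IsLeaf G l → Dominates l p → Dominates s p
  leaf-N[]⊆stem-N[] sl leaf (inj₁ refl) = inj₂ (sym G sl)
  leaf-N[]⊆stem-N[] sl leaf (inj₂ pl)   = inj₁ (≡.sym (leaf-nbr-unique sl leaf (sym G pl)))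

  soleDominator⇒InN₁ : ∀ {S v s} → v ∉ S → s ∈ S → Adj G v s →
                       (∀ {w} → w ∈ S → Adj G v w → w ≡ s) → InN₁ G S v
  soleDominator⇒InN₁ {S} {v} {s} v∉S s∈S vs sole =
    v∉S , trans (cong ∣_∣ (⊆-antisym onlyS hasS)) (∣⁅x⁆∣≡1 s)
    where
    onlyS : ∀ {x} → x ∈ N[ G ] v ∩ S → x ∈ ⁅ s ⁆
    onlyS x∈ with x∈p∩q⁻ (N[ G ] v) S x∈
    ... | x∈N[v] , x∈S with x∈p∪q⁻ ⁅ v ⁆ (N G v) x∈N[v]
    ... | inj₁ x∈⁅v⁆ = ⊥-elim (v∉S (subst (_∈ S) (x∈⁅y⁆⇒x≡y v x∈⁅v⁆) x∈S))
    ... | inj₂ vx    = subst (_∈ ⁅ s ⁆) (≡.sym (sole x∈S vx)) (x∈⁅x⁆ s)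
    hasS : ∀ {x} → x ∈ ⁅ s ⁆ → x ∈ N[ G ] v ∩ S
    hasS x∈⁅s⁆ with x∈⁅y⁆⇒x≡y s x∈⁅s⁆
    ... | refl = x∈p∩q⁺ (x∈p∪q⁺ (inj₂ vs) , s∈S)

  ¬InN₁⇒otherDominator : ∀ {S v s} → v ∉ S → s ∈ S → Adj G v s → ¬ InN₁ G S v →
                         ∃[ w ] (w ∈ S × Adj G v w × w ≢ s)
  ¬InN₁⇒otherDominator {S} {v} {s} v∉S s∈S vs v∉N₁
    with any? (λ w → (w ∈? S) ×-dec ((w ∈? N G v) ×-dec ¬? (w ≟ s)))
  ... | yes other = other
  ... | no none   = ⊥-elim (v∉N₁ (soleDominator⇒InN₁ v∉S s∈S vs sole))
    where
    sole : ∀ {w} → w ∈ S → Adj G v w → w ≡ s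
    sole {w} w∈S vw = decidable-stable (w ≟ s) (λ w≢s → none (w , w∈S , vw , w≢s))

module Swap {n : ℕ} (G : Graph n) (M : Subset n) (s : Fin n) where

  L : Subset n
  L = LeafNbrs G s

  M' : Subset n
  M' = (M ∪ L) - s

  ∈M'⁻ : ∀ {x} → x ∈ M' → (x ∈ M ⊎ x ∈ L) × x ≢ s
  ∈M'⁻ x∈ = x∈p∪q⁻ M L (p─q⊆p (M ∪ L) ⁅ s ⁆ x∈) , x∈p-y⇒x≢y (M ∪ L) x∈

  ∈M'⁺ : ∀ {x} → x ∈ M ⊎ x ∈ L → x ≢ s → x ∈ M'
  ∈M'⁺ x∈ x≢s = x∈p∧x≢y⇒x∈p-y (x∈p∪q⁺ x∈) x≢s

  module _ (s∈M : s ∈ M)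
           (N₁-free : ∀ u → Adj G s u → ¬ IsLeaf G u → ¬ InN₁ G M u) where

    nbr-dominated : ∀ {v} → Adj G v s → Dominated G M' v
    nbr-dominated {v} vs with ∣ N G v ∣ ≟ℕ 1
    ... | yes leaf = v , ∈M'⁺ (inj₂ (∈LeafNbrs⁺ G (sym G vs) leaf)) (adj⇒≢ G (sym G vs)) , inj₁ refl
    ... | no ¬leaf with v ∈? M
    ... | yes v∈M = v , ∈M'⁺ (inj₁ v∈M) (adj⇒≢ G (sym G vs)) , inj₁ refl
    ... | no v∉M with ¬InN₁⇒otherDominator G v∉M s∈M vs (N₁-free v (sym G vs) ¬leaf)
    ... | w , w∈M , vw , w≢s = w , ∈M'⁺ (inj₁ w∈M) w≢s , inj₂ vw

    dominating : Dominating G M → IsStem G s → Dominating G M'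
    dominating D (l , sl , leaf) = dominated⇒dominating G dominated
      where
      dominated : ∀ v → Dominated G M' v
      dominated v with v ≟ s
      ... | yes refl = l , ∈M'⁺ (inj₂ (∈LeafNbrs⁺ G sl leaf)) (adj⇒≢ G sl) , inj₂ sl
      ... | no v≢s with dominating⇒dominated G D v
      ... | u , u∈M , uv with u ≟ s
      ... | no u≢s = u , ∈M'⁺ (inj₁ u∈M) u≢s , uv
      ... | yes refl with uv
      ... | inj₁ refl = ⊥-elim (v≢s refl)
      ... | inj₂ vs   = nbr-dominated vs

  leaf-privateNbr : ∀ {x} → x ∈ L → PrivateNbr G M' x x
  leaf-privateNbr {x} x∈L with ∈LeafNbrs⁻ G x∈L
  ... | sx , leaf = inj₁ refl , isPrivate
    where
    isPrivate : ∀ u → u ∈ M' → Dominates G u x → u ≡ x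
    isPrivate u u∈M' (inj₁ u≡x) = u≡x
    isPrivate u u∈M' (inj₂ xu)  = ⊥-elim (proj₂ (∈M'⁻ u∈M') (leaf-nbr-unique G sx leaf xu))

  privateNbr-preserved : ∀ {x p} → s ∈ M → x ≢ s → PrivateNbr G M x p → PrivateNbr G M' x p
  privateNbr-preserved {x} {p} s∈M x≢s (xp , isPrivateM) = xp , isPrivate
    where
    isPrivate : ∀ u → u ∈ M' → Dominates G u p → u ≡ x
    isPrivate u u∈M' up with proj₁ (∈M'⁻ u∈M')
    ... | inj₁ u∈M = isPrivateM u u∈M up
    ... | inj₂ u∈L with ∈LeafNbrs⁻ G u∈L
    ... | su , leaf = ⊥-elim (x≢s (≡.sym (isPrivateM s s∈M (leaf-N[]⊆stem-N[] G su leaf up))))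

  privateNbrs : MinimalDominating G M → s ∈ M → ∀ x → x ∈ M' → ∃[ p ] PrivateNbr G M' x p
  privateNbrs minM s∈M x x∈M' with ∈M'⁻ x∈M'
  ... | inj₂ x∈L , _   = x , leaf-privateNbr x∈L
  ... | inj₁ x∈M , x≢s with minimal⇒privateNbrs G M minM x x∈M
  ... | p , xp = p , privateNbr-preserved s∈M x≢s xp

  oneSided : s ∈ M → OneSided G M' M
  oneSided s∈M = s , removed , (s∈M , λ s∈M' → proj₂ (∈M'⁻ s∈M') refl) , added
    where
    removed : ∀ x → x ∈ M × x ∉ M' → x ≡ s
    removed x (x∈M , x∉M') with x ≟ s
    ... | yes x≡s = x≡s
    ... | no x≢s  = ⊥-elim (x∉M' (∈M'⁺ (inj₁ x∈M) x≢s))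
    added : ∀ x → x ∈ M' → x ∉ M → Adj G s x
    added x x∈M' x∉M with proj₁ (∈M'⁻ x∈M')
    ... | inj₁ x∈M = ⊥-elim (x∉M x∈M)
    ... | inj₂ x∈L = proj₁ (∈LeafNbrs⁻ G x∈L)

lemma2 : {n : ℕ} (T : Graph n) → IsTree T → (M : Subset n) → MinimalDominating T M →
         (s : Fin n) → IsStem T s → s ∈ M →
         (∀ u → Adj T s u → ¬ IsLeaf T u → ¬ InN₁ T M u) →
         MinimalDominating T ((M ∪ LeafNbrs T s) - s) × RAdj T ((M ∪ LeafNbrs T s) - s) M
lemma2 T _ M minM s stem s∈M N₁-free = minM' , minM' , minM , inj₁ (oneSided s∈M)
  where
  open Swap T M s
  minM' : MinimalDominating T M'
  minM' = privateNbrs⇒minimal T M' (dominating s∈M N₁-free (proj₁ minM) stem) (privateNbrs minM s∈M)
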